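{- For integers $k\ge 1$ and $n\ge 0$, the number of $132$-avoiding $k$-ary shrub forests with $n$ shrubs is $$\left|\mathcal{F}^k_n(132)\right|=\frac{1}{(k+1)n+1}\binom{(k+2)n}{n}.$$
   Context: A $k$-ary shrub is a rooted tree whose root has exactly $k$ children, all leaves. A $k$-ary shrub forest of $n$ shrubs is an ordered sequence of $n$ such shrubs (leaves ordered left to right) whose $(k+1)n$ vertices are labeled bijectively by $\{1,\dots,(k+1)n\}$ so that each leaf has a larger label than its root; its permutation $\pi_F$ is read shrub by shrub, root label first and then leaf labels from left to right. Equivalently, forests correspond to permutations $\pi$ of $\{1,\dots,(k+1)n\}$ with $\pi_{(k+1)i+1}<\pi_{(k+1)i+j}$ for $0\le i<n$, $2\le j\le k+1$. $\mathcal{F}^k_n(P)$ is the set of such forests whose permutation avoids (classically) all patterns in $P$. -}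

module Defs where

open import Data.Nat using (ℕ; zero; suc; _+_; _*_; _<_; _≤_)
open import Data.List using (List; []; _∷_; length; map; upTo)
open import Data.List.Relation.Binary.Permutation.Propositional using (_↭_)
open import Data.Product using (Σ; _×_; ∃-syntax)
open import Relation.Nullary using (¬_)

-- 0-indexed entry of a word; out-of-range positions give 0 (never used
-- for in-range positions, which are the only ones the definitions query).
at : List ℕ → ℕ → ℕ
at []       _       = 0
at (x ∷ xs) zero    = x
at (x ∷ xs) (suc i) = at xs i

IsPermOf : ℕ → List ℕ → Set
IsPermOf m π = π ↭ map suc (upTo m)

-- π is the permutation of a k-ary shrub forest with n shrubs:
-- π is a permutation of {1,…,(k+1)n} and, 1-indexed,
-- π_{(k+1)i+1} < π_{(k+1)i+j} for 0 ≤ i < n, 2 ≤ j ≤ k+1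
-- (0-indexed: position (k+1)i versus (k+1)i + j' for 1 ≤ j' ≤ k).
IsShrubForestPerm : ℕ → ℕ → List ℕ → Set
IsShrubForestPerm k n π =
  IsPermOf ((suc k) * n) π ×
  (∀ i j → i < n → 1 ≤ j → j ≤ k →
     at π ((suc k) * i) < at π ((suc k) * i + j))

Contains132 : List ℕ → Set
Contains132 π = ∃[ a ] ∃[ b ] ∃[ c ]
  (a < b × b < c × c < length π ×
   at π a < at π c × at π c < at π b)

Avoids132 : List ℕ → Set
Avoids132 π = ¬ Contains132 π

InF132 : ℕ → ℕ → List ℕ → Set
InF132 k n π = IsShrubForestPerm k n π × Avoids132 π

module Submission where

-- Idea: generate the 132-avoiding forest permutations by a stack process
-- that places the values m, m−1, …, 1 (m = (k+1)n) in decreasing order.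
-- A push puts the next value -- the smallest so far -- on top of the
-- increasing stack; a pop moves the top k+1 stack entries, as a new shrub,
-- to the end of the output.  The configurations reachable after u pushes
-- and d pops are exactly those satisfying an invariant (Process.Inv): both
-- steps preserve it (soundness), the last step of a configuration can
-- always be undone (completeness), and every configuration arises once.
-- Their number therefore satisfies the ballot recurrence for lattice paths
-- with steps +1 and −(k+1), whose closed form gives the Fuss–Catalan
-- number; the final configurations (m pushes, n pops) are the forests.

open import Defs
open import Data.Nat using (ℕ; zero; suc; _+_; _*_; _∸_; _/_; _≤_; _<_; _≤ᵇ_; z≤n; s≤s; NonZero)
open import Data.Nat.Properties
open import Data.Nat.Combinatorics using (_C_; nCk+nC[k+1]≡[n+1]C[k+1])
open import Data.Nat.DivMod using (m*n/n≡m)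
open import Data.Nat.Tactic.RingSolver using (solve-∀)
open import Data.Bool using (true; false; if_then_else_; T)
open import Data.Unit using (tt)
open import Data.List using (List; []; _∷_; _++_; length; map; take; drop; upTo; applyUpTo)
open import Data.List.Properties using (map-upTo; length-upTo; ∷-injective; ++-assoc; length-++; length-map; length-take; length-drop; take++drop≡id; ++-identityʳ)
open import Data.List.Membership.Propositional using (_∈_)
open import Data.List.Membership.Propositional.Properties using (∈-++⁺ˡ; ∈-++⁺ʳ; ∈-++⁻; ∈-map⁺; ∈-map⁻)
open import Data.List.Relation.Unary.Any using (here; there)
open import Data.List.Relation.Unary.All as All using (All; []; _∷_)
import Data.List.Relation.Unary.All.Properties as All
open import Data.List.Relation.Unary.AllPairs as AllPairs using (AllPairs; []; _∷_)
import Data.List.Relation.Unary.AllPairs.Properties as AllPairs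
open import Data.List.Relation.Unary.Unique.Propositional using (Unique)
import Data.List.Relation.Unary.Unique.Propositional.Properties as Unique
open import Data.List.Relation.Binary.Sublist.Propositional using (_⊆_; []; _∷_; _∷ʳ_; ⊆-refl; ⊆-trans; from∈; to∈)
open import Data.List.Relation.Binary.Sublist.Propositional.Properties using (++⁺ˡ; ++⁺ʳ; ++⁺)
open import Data.List.Relation.Binary.Permutation.Propositional using (_↭_; ↭-refl; ↭-prep; ↭-trans; ↭-sym; ↭⇒↭ₛ)
open import Data.List.Relation.Binary.Permutation.Propositional.Properties using (All-resp-↭; ∈-resp-↭; shift; ↭-length; drop-∷; ↭-empty-inv)
import Data.List.Relation.Binary.Permutation.Setoid.Properties as Perm
open import Data.Product using (_×_; _,_; ∃-syntax; proj₁; proj₂)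
open import Data.Sum using (_⊎_; inj₁; inj₂)
open import Data.Empty using (⊥; ⊥-elim)
open import Function.Bundles using (_⇔_; mk⇔; Equivalence)
open import Relation.Nullary using (¬_)
open import Relation.Binary.Definitions using (tri<; tri≈; tri>)
open import Relation.Binary.PropositionalEquality

at-++ˡ : ∀ xs ys i → i < length xs → at (xs ++ ys) i ≡ at xs i
at-++ˡ (x ∷ xs) ys zero    _         = refl
at-++ˡ (x ∷ xs) ys (suc i) (s≤s i<n) = at-++ˡ xs ys i i<n

at-++ʳ : ∀ xs ys j → at (xs ++ ys) (length xs + j) ≡ at ys j
at-++ʳ []       ys j = refl
at-++ʳ (x ∷ xs) ys j = at-++ʳ xs ys j

at-∈ : ∀ xs i → i < length xs → at xs i ∈ xs
at-∈ (x ∷ xs) zero    _         = here refl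
at-∈ (x ∷ xs) (suc i) (s≤s i<n) = there (at-∈ xs i i<n)

at₂-⊆ : ∀ π i j → i < j → j < length π → at π i ∷ at π j ∷ [] ⊆ π
at₂-⊆ (x ∷ π) zero    (suc j) _         (s≤s j<n) = refl ∷ from∈ (at-∈ π j j<n)
at₂-⊆ (x ∷ π) (suc i) (suc j) (s≤s i<j) (s≤s j<n) = x ∷ʳ at₂-⊆ π i j i<j j<n

at₃-⊆ : ∀ π i j l → i < j → j < l → l < length π →
  at π i ∷ at π j ∷ at π l ∷ [] ⊆ π
at₃-⊆ (x ∷ π) zero    (suc j) (suc l) _         (s≤s j<l) (s≤s l<n) = refl ∷ at₂-⊆ π j l j<l l<n
at₃-⊆ (x ∷ π) (suc i) (suc j) (suc l) (s≤s i<j) (s≤s j<l) (s≤s l<n) = x ∷ʳ at₃-⊆ π i j l i<j j<l l<n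

⊆-at : ∀ {a π} → a ∷ [] ⊆ π → ∃[ i ] (i < length π × at π i ≡ a)
⊆-at (y ∷ʳ p) with ⊆-at p
... | i , i<n , e = suc i , s≤s i<n , e
⊆-at (refl ∷ p) = 0 , s≤s z≤n , refl

⊆-at₂ : ∀ {a b π} → a ∷ b ∷ [] ⊆ π →
  ∃[ i ] ∃[ j ] (i < j × j < length π × at π i ≡ a × at π j ≡ b)
⊆-at₂ (y ∷ʳ p) with ⊆-at₂ p
... | i , j , i<j , j<n , ea , eb = suc i , suc j , s≤s i<j , s≤s j<n , ea , eb
⊆-at₂ (refl ∷ p) with ⊆-at p
... | j , j<n , eb = 0 , suc j , s≤s z≤n , s≤s j<n , refl , eb

⊆-at₃ : ∀ {a b c π} → a ∷ b ∷ c ∷ [] ⊆ π →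
  ∃[ i ] ∃[ j ] ∃[ l ] (i < j × j < l × l < length π × at π i ≡ a × at π j ≡ b × at π l ≡ c)
⊆-at₃ (y ∷ʳ p) with ⊆-at₃ p
... | i , j , l , i<j , j<l , l<n , ea , eb , ec =
  suc i , suc j , suc l , s≤s i<j , s≤s j<l , s≤s l<n , ea , eb , ec
⊆-at₃ (refl ∷ p) with ⊆-at₂ p
... | j , l , j<l , l<n , eb , ec = 0 , suc j , suc l , s≤s z≤n , s≤s j<l , s≤s l<n , refl , eb , ec

Free132 : List ℕ → Set
Free132 π = ∀ {a b c} → a ∷ b ∷ c ∷ [] ⊆ π → a < c → c < b → ⊥

avoids⇔free132 : ∀ π → Avoids132 π ⇔ Free132 π
avoids⇔free132 π = mk⇔ to from
  where
  to : Avoids132 π → Free132 π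
  to av abc a<c c<b with ⊆-at₃ abc
  ... | i , j , l , i<j , j<l , l<n , refl , refl , refl = av (i , j , l , i<j , j<l , l<n , a<c , c<b)
  from : Free132 π → Avoids132 π
  from fr (i , j , l , i<j , j<l , l<n , a<c , c<b) = fr (at₃-⊆ π i j l i<j j<l l<n) a<c c<b

free132-⊆ : ∀ {xs ys} → xs ⊆ ys → Free132 ys → Free132 xs
free132-⊆ xs⊆ys fr abc = fr (⊆-trans abc xs⊆ys)

increasing-⊆ : ∀ {b c s} → AllPairs _<_ s → b ∷ c ∷ [] ⊆ s → b < c
increasing-⊆ (_  ∷ s<) (_ ∷ʳ bc)   = increasing-⊆ s< bc
increasing-⊆ (b< ∷ _)  (refl ∷ c∈) = All.lookup b< (to∈ c∈)

⊆-split : ∀ (o : List ℕ) {p s L} → L ⊆ o ++ p ∷ s →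
  L ⊆ o ++ s ⊎ ∃[ L₁ ] ∃[ L₂ ] (L ≡ L₁ ++ p ∷ L₂ × L₁ ⊆ o × L₂ ⊆ s)
⊆-split []      (_ ∷ʳ L⊆)    = inj₁ L⊆
⊆-split []      (refl ∷ L⊆)  = inj₂ ([] , _ , refl , [] , L⊆)
⊆-split (x ∷ o) (_ ∷ʳ L⊆) with ⊆-split o L⊆
... | inj₁ L⊆′                       = inj₁ (x ∷ʳ L⊆′)
... | inj₂ (L₁ , L₂ , refl , L₁⊆ , L₂⊆) = inj₂ (L₁ , L₂ , refl , x ∷ʳ L₁⊆ , L₂⊆)
⊆-split (x ∷ o) (refl ∷ L⊆) with ⊆-split o L⊆
... | inj₁ L⊆′                       = inj₁ (refl ∷ L⊆′)
... | inj₂ (L₁ , L₂ , refl , L₁⊆ , L₂⊆) = inj₂ (x ∷ L₁ , L₂ , refl , refl ∷ L₁⊆ , L₂⊆)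

-- Inserting a value p below all entries between a word o and an
-- increasing word s preserves 132-avoidance: p can only play the role
-- of the 1, and then the 3 and the 2 both lie in the increasing s.
free132-insert : ∀ o {p s} → Free132 (o ++ s) → AllPairs _<_ s →
  All (p <_) (o ++ s) → Free132 (o ++ p ∷ s)
free132-insert o {p} {s} fr s< p< abc a<c c<b with ⊆-split o abc
... | inj₁ abc′ = fr abc′ a<c c<b
... | inj₂ ([] , _ , refl , _ , bc⊆s) = <-asym c<b (increasing-⊆ s< bc⊆s)
... | inj₂ (_ ∷ [] , _ , refl , a⊆o , _) =
  <-asym (<-trans a<c c<b) (All.lookup p< (∈-++⁺ˡ (to∈ a⊆o)))
... | inj₂ (_ ∷ _ ∷ [] , _ , refl , ab⊆o , _) =
  <-asym a<c (All.lookup p< (∈-++⁺ˡ (to∈ (⊆-trans (refl ∷ (_ ∷ʳ [])) ab⊆o))))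
... | inj₂ (_ ∷ _ ∷ _ ∷ [] , _ , () , _)
... | inj₂ (_ ∷ _ ∷ _ ∷ _ ∷ _ , _ , () , _)

unique-disjoint : ∀ (o : List ℕ) {s x} → Unique (o ++ s) → x ∈ o → x ∈ s → ⊥
unique-disjoint (y ∷ o) (y∉ ∷ _) (here refl) x∈s = All.lookup y∉ (∈-++⁺ʳ o x∈s) refl
unique-disjoint (y ∷ o) (_ ∷ u)  (there x∈o) x∈s = unique-disjoint o u x∈o x∈s

unique-++ˡ : ∀ (o : List ℕ) {s} → Unique (o ++ s) → Unique o
unique-++ˡ []      _          = []
unique-++ˡ (x ∷ o) (x∉ ∷ u) = All.++⁻ˡ o x∉ ∷ unique-++ˡ o u

unique-++ʳ : ∀ (o : List ℕ) {s} → Unique (o ++ s) → Unique s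
unique-++ʳ []      u       = u
unique-++ʳ (x ∷ o) (_ ∷ u) = unique-++ʳ o u

unique-resp-↭ : ∀ {xs ys : List ℕ} → xs ↭ ys → Unique xs → Unique ys
unique-resp-↭ xs↭ys = Perm.Unique-resp-↭ (setoid ℕ) (↭⇒↭ₛ xs↭ys)

-- The leaves of a shrub in a 132-avoiding word: if x precedes and lies
-- below the distinct entries ys, then ys is increasing (a descent y > y′
-- would give the pattern x y y′).
leaves-increasing : ∀ x ys → Free132 (x ∷ ys) → All (x <_) ys → Unique ys →
  AllPairs _<_ ys
leaves-increasing x []       _  _         _          = []
leaves-increasing x (y ∷ ys) fr (x<y ∷ x<) (y∉ ∷ u) =
  All.tabulate y<_ ∷ leaves-increasing x ys (free132-⊆ (refl ∷ y ∷ʳ ⊆-refl) fr) x< u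
  where
  y<_ : ∀ {y′} → y′ ∈ ys → y < y′
  y<_ {y′} y′∈ with <-cmp y y′
  ... | tri< y<y′ _ _ = y<y′
  ... | tri≈ _ y≡y′ _ = ⊥-elim (All.lookup y∉ y′∈ y≡y′)
  ... | tri> _ _ y′<y = ⊥-elim (fr (refl ∷ refl ∷ from∈ y′∈) (All.lookup x< y′∈) y′<y)

-- Otherwise some leaf y > z ∈ s
-- would give the pattern p y z.
last-shrub-increasing : ∀ o′ x ys s p →
  Unique (o′ ++ x ∷ ys ++ s) → Free132 (o′ ++ x ∷ ys ++ s) →
  AllPairs _<_ s → All (x <_) ys →
  p ∈ o′ ++ x ∷ ys → All (p ≤_) (o′ ++ x ∷ ys ++ s) →
  AllPairs _<_ (x ∷ ys ++ s)
last-shrub-increasing o′ x ys s p u fr s< x< p∈ p≤ =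
  AllPairs.++⁺ (x< ∷ leaves-increasing x ys fr-shrub x< u-leaves) s<
    (All.tabulate λ y∈ → All.tabulate λ z∈ → shrub<stack y∈ z∈)
  where
  u-block : Unique (x ∷ ys ++ s)
  u-block = unique-++ʳ o′ u

  u-leaves : Unique ys
  u-leaves with u-block
  ... | _ ∷ u′ = unique-++ˡ ys u′

  fr-shrub : Free132 (x ∷ ys)
  fr-shrub = free132-⊆ (++⁺ˡ o′ (++⁺ʳ s ⊆-refl)) fr

  shrub<stack : ∀ {y z} → y ∈ x ∷ ys → z ∈ s → y < z
  shrub<stack {y} {z} y∈ z∈ with <-cmp y z
  ... | tri< y<z _ _ = y<z
  ... | tri≈ _ refl _ = ⊥-elim (unique-disjoint (x ∷ ys) u-block y∈ z∈)
  ... | tri> _ _ z<y = ⊥-elim (occurrence (∈-++⁻ o′ p∈))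
    where
    p<z : p < z
    p<z with m≤n⇒m<n∨m≡n (All.lookup p≤ (∈-++⁺ʳ o′ (∈-++⁺ʳ (x ∷ ys) z∈)))
    ... | inj₁ p<z  = p<z
    ... | inj₂ refl = ⊥-elim (unique-disjoint (o′ ++ x ∷ ys)
                        (subst Unique (sym (++-assoc o′ (x ∷ ys) s)) u) p∈ z∈)
    occurrence : p ∈ o′ ⊎ p ∈ x ∷ ys → ⊥
    occurrence (inj₁ p∈o′) = fr (++⁺ (from∈ p∈o′) (++⁺ (from∈ y∈) (from∈ z∈))) p<z z<y
    occurrence (inj₂ (here refl)) = root-before y∈
      where
      root-before : y ∈ x ∷ ys → ⊥
      root-before (here refl)  = <-asym p<z z<y
      root-before (there y∈ys) = fr (++⁺ˡ o′ (refl ∷ ++⁺ (from∈ y∈ys) (from∈ z∈))) p<z z<y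
    occurrence (inj₂ (there p∈ys)) =
      <-irrefl refl (<-≤-trans (All.lookup x< p∈ys) (All.lookup p≤ (∈-++⁺ʳ o′ (here refl))))

-- Binomial coefficients by Pascal's rule; unlike the library's _C_ they
-- compute on constructor arguments, which keeps the inductions below short.
binom : ℕ → ℕ → ℕ
binom n       zero    = 1
binom zero    (suc j) = 0
binom (suc n) (suc j) = binom n j + binom n (suc j)

binom≡C : ∀ n j → binom n j ≡ n C j
binom≡C n       zero    = refl
binom≡C zero    (suc j) = refl
binom≡C (suc n) (suc j) =
  trans (cong₂ _+_ (binom≡C n j) (binom≡C n (suc j))) (nCk+nC[k+1]≡[n+1]C[k+1] n j)

binom-absorb : ∀ n j → suc j * binom (suc n) (suc j) ≡ suc n * binom n j
binom-absorb zero    zero    = refl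
binom-absorb zero    (suc j) = *-zeroʳ (suc (suc j))
binom-absorb (suc n) zero    =
  trans (*-identityˡ _) (cong suc (trans (sym (*-identityˡ _)) (binom-absorb n zero)))
binom-absorb (suc n) (suc j) = begin
  suc (suc j) * (binom (suc n) (suc j) + binom (suc n) (suc (suc j)))
    ≡⟨ *-distribˡ-+ (suc (suc j)) (binom (suc n) (suc j)) _ ⟩
  suc (suc j) * binom (suc n) (suc j) + suc (suc j) * binom (suc n) (suc (suc j))
    ≡⟨ cong₂ (λ a b → binom (suc n) (suc j) + a + b) (binom-absorb n j) (binom-absorb n (suc j)) ⟩
  binom (suc n) (suc j) + suc n * binom n j + suc n * binom n (suc j)
    ≡⟨ regroup (binom (suc n) (suc j)) (suc n) (binom n j) (binom n (suc j)) ⟩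
  suc (suc n) * binom (suc n) (suc j) ∎
  where
  open ≡-Reasoning
  regroup : ∀ a b c d → a + b * c + b * d ≡ a + b * (c + d)
  regroup = solve-∀

binom-absorb-pascal : ∀ M d →
  suc d * binom M (suc d) + suc d * binom M d ≡ suc M * binom M d
binom-absorb-pascal M d = begin
  suc d * binom M (suc d) + suc d * binom M d ≡⟨ +-comm (suc d * binom M (suc d)) _ ⟩
  suc d * binom M d + suc d * binom M (suc d) ≡⟨ *-distribˡ-+ (suc d) (binom M d) _ ⟨
  suc d * binom (suc M) (suc d)               ≡⟨ binom-absorb M d ⟩
  suc M * binom M d                           ∎
  where open ≡-Reasoning

binom-shift : ∀ j q → binom (suc (j + q)) j * suc q ≡ binom (j + q) j * suc (j + q)
binom-shift zero    q = refl
binom-shift (suc i) q = begin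
  (Bᵢ + Bₛ) * suc q               ≡⟨ *-distribʳ-+ (suc q) Bᵢ Bₛ ⟩
  Bᵢ * suc q + Bₛ * suc q         ≡⟨ cong (_+ Bₛ * suc q) (trans (*-comm Bᵢ (suc q)) (sym absorbed)) ⟩
  suc i * Bₛ + Bₛ * suc q         ≡⟨ collect i Bₛ q ⟩
  Bₛ * suc (suc i + q)            ∎
  where
  open ≡-Reasoning
  N  = suc i + q
  Bᵢ = binom N i
  Bₛ = binom N (suc i)
  absorbed : suc i * Bₛ ≡ suc q * Bᵢ
  absorbed = +-cancelˡ-≡ (suc i * Bᵢ) _ _ (begin
    suc i * Bᵢ + suc i * Bₛ   ≡⟨ +-comm (suc i * Bᵢ) _ ⟩
    suc i * Bₛ + suc i * Bᵢ   ≡⟨ binom-absorb-pascal N i ⟩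
    suc N * Bᵢ                ≡⟨ cong (_* Bᵢ) (sym (+-suc (suc i) q)) ⟩
    (suc i + suc q) * Bᵢ      ≡⟨ *-distribʳ-+ Bᵢ (suc i) (suc q) ⟩
    suc i * Bᵢ + suc q * Bᵢ   ∎)
  collect : ∀ i b q → suc i * b + b * suc q ≡ b * suc (suc i + q)
  collect = solve-∀

-- The algebraic core of the ballot recurrence: with M = r e + x + e,
-- A₁ = x C(M,e) / M and A₂ = (x+r+1) C(M,d) / M (where e = d + 1) add up to
-- (x+1) C(M+1,e) / (M+1).
ballot-identity : ∀ r e x A₁ A₂ Cd Ce M → M ≡ r * e + x + e →
  A₁ * M ≡ x * Ce → A₂ * M ≡ (x + r + 1) * Cd →
  e * Ce + e * Cd ≡ suc M * Cd → .{{NonZero (M * e)}} →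
  (A₁ + A₂) * suc M ≡ (x + 1) * (Cd + Ce)
ballot-identity r e x A₁ A₂ Cd Ce _ refl h₁ h₂ absorb =
  *-cancelʳ-≡ _ _ (M * e) (+-cancelʳ-≡ X _ _ (begin
    (A₁ + A₂) * suc M * (M * e) + X
      ≡⟨ expand A₁ A₂ M e x Cd ⟩
    (A₁ * M) * suc M * e + (A₂ * M) * suc M * e + X
      ≡⟨ cong₂ (λ a b → a * suc M * e + b * suc M * e + X) h₁ h₂ ⟩
    (x * Ce) * suc M * e + ((x + r + 1) * Cd) * suc M * e + X
      ≡⟨ gather x Ce M e r Cd ⟩
    x * suc M * (e * Ce + e * Cd) + ((x + r + 1) * Cd) * suc M * e
      ≡⟨ cong (λ z → x * suc M * z + ((x + r + 1) * Cd) * suc M * e) absorb ⟩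
    x * suc M * (suc M * Cd) + ((x + r + 1) * Cd) * suc M * e
      ≡⟨ unfoldM x r e Cd ⟩
    (x + 1) * M * (suc M * Cd) + X
      ≡⟨ cong (λ z → (x + 1) * M * z + X) (sym absorb) ⟩
    (x + 1) * M * (e * Ce + e * Cd) + X
      ≡⟨ regroup x M e Ce Cd ⟩
    (x + 1) * (Cd + Ce) * (M * e) + X ∎))
  where
  open ≡-Reasoning
  M = r * e + x + e
  X = x * suc M * e * Cd
  expand : ∀ a b m e x c → (a + b) * suc m * (m * e) + x * suc m * e * c
         ≡ (a * m) * suc m * e + (b * m) * suc m * e + x * suc m * e * c
  expand = solve-∀
  gather : ∀ x f m e r c → (x * f) * suc m * e + ((x + r + 1) * c) * suc m * e + x * suc m * e * c
         ≡ x * suc m * (e * f + e * c) + ((x + r + 1) * c) * suc m * e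
  gather = solve-∀
  unfoldM : ∀ x r e c →
    x * suc (r * e + x + e) * (suc (r * e + x + e) * c) + ((x + r + 1) * c) * suc (r * e + x + e) * e
    ≡ (x + 1) * (r * e + x + e) * (suc (r * e + x + e) * c) + x * suc (r * e + x + e) * e * c
  unfoldM = solve-∀
  regroup : ∀ x m e f c → (x + 1) * m * (e * f + e * c) + x * suc m * e * c
          ≡ (x + 1) * (c + f) * (m * e) + x * suc m * e * c
  regroup = solve-∀

-- Ballot numbers for lattice paths with up-steps +1 (place a value on the
-- stack) and down-steps −r, r = k+1 (emit a shrub): ballot u d counts the
-- paths with u up-steps and d down-steps that never go below height 0,
-- the height after them being u ∸ r d.
module Ballot (k : ℕ) where

  r : ℕ
  r = suc k

  ifDownStep : ℕ → ℕ → ℕ → ℕ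
  ifDownStep u d b = if r ≤ᵇ (u ∸ r * d) then b else 0

  ballot : ℕ → ℕ → ℕ
  ballot u       zero    = 1
  ballot zero    (suc d) = ifDownStep 0 d (ballot 0 d)
  ballot (suc u) (suc d) = ballot u (suc d) + ifDownStep (suc u) d (ballot (suc u) d)

  data DownStep (t d : ℕ) : Set where
    blocked : (r ≤ᵇ (t ∸ r * d)) ≡ false → t < r * suc d → DownStep t d
    allowed : (r ≤ᵇ (t ∸ r * d)) ≡ true → ∀ x → t ≡ r * suc d + x → DownStep t d

  downStep : ∀ t d → DownStep t d
  downStep t d with r ≤ᵇ (t ∸ r * d) in guard
  ... | true  = allowed guard (t ∸ r * suc d) (sym (m+[n∸m]≡n r[d+1]≤t))
    where
    r≤height : r ≤ t ∸ r * d
    r≤height = ≤ᵇ⇒≤ r _ (subst T (sym guard) tt)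
    rd≤t : r * d ≤ t
    rd≤t = <⇒≤ (m∸n≢0⇒n<m λ height≡0 → r≰0 (subst (r ≤_) height≡0 r≤height))
      where
      r≰0 : ¬ (r ≤ 0)
      r≰0 ()
    r[d+1]≤t : r * suc d ≤ t
    r[d+1]≤t = subst (_≤ t) (sym (*-suc r d)) (m≤o∸n⇒m+n≤o r rd≤t r≤height)
  ... | false = blocked guard (≰⇒> r[d+1]≰t)
    where
    r[d+1]≰t : ¬ (r * suc d ≤ t)
    r[d+1]≰t r[d+1]≤t = subst T guard (≤⇒≤ᵇ (m+n≤o⇒m≤o∸n r (subst (_≤ t) (*-suc r d) r[d+1]≤t)))

  blocked-step : ∀ t d A → t < r * suc d →
    A * (t + suc d) ≡ (t ∸ r * suc d) * binom (t + suc d) (suc d) →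
    (A + 0) * suc (t + suc d) ≡ (suc t ∸ r * suc d) * binom (suc (t + suc d)) (suc d)
  blocked-step t d A t<r[d+1] closed = begin
    (A + 0) * suc (t + suc d)  ≡⟨ cong (λ a → a * suc (t + suc d)) (trans (+-identityʳ A) A≡0) ⟩
    0                          ≡⟨ cong (_* binom (suc (t + suc d)) (suc d)) (sym (m≤n⇒m∸n≡0 t<r[d+1])) ⟩
    (suc t ∸ r * suc d) * binom (suc (t + suc d)) (suc d) ∎
    where
    open ≡-Reasoning
    A≡0 : A ≡ 0
    A≡0 with m*n≡0⇒m≡0∨n≡0 A {t + suc d} (trans closed
               (cong (_* binom (t + suc d) (suc d)) (m≤n⇒m∸n≡0 (<⇒≤ t<r[d+1]))))
    ... | inj₁ A≡0 = A≡0
    ... | inj₂ t+d+1≡0 = ⊥-elim (m+1+n≢0 t t+d+1≡0)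

  allowed-step : ∀ t d x A₁ A₂ → t ≡ r * suc d + x →
    A₁ * (t + suc d) ≡ (t ∸ r * suc d) * binom (t + suc d) (suc d) →
    A₂ * suc (t + d) ≡ (suc t ∸ r * d) * binom (suc (t + d)) d →
    (A₁ + A₂) * suc (t + suc d) ≡ (suc t ∸ r * suc d) * binom (suc (t + suc d)) (suc d)
  allowed-step _ d x A₁ A₂ refl closed₁ closed₂ = begin
    (A₁ + A₂) * suc M
      ≡⟨ ballot-identity r (suc d) x A₁ A₂ (binom M d) (binom M (suc d)) M refl h₁ h₂
           (binom-absorb-pascal M d) {{m*n≢0 M (suc d) {{M≢0}}}} ⟩
    (x + 1) * binom (suc M) (suc d)
      ≡⟨ cong (_* binom (suc M) (suc d)) (sym height′) ⟩
    (suc t ∸ r * suc d) * binom (suc M) (suc d) ∎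
    where
    open ≡-Reasoning
    t = r * suc d + x
    M = t + suc d
    M≢0 : NonZero M
    M≢0 = subst NonZero (sym (+-suc t d)) _
    height : t ∸ r * suc d ≡ x
    height = m+n∸m≡n (r * suc d) x
    height′ : suc t ∸ r * suc d ≡ x + 1
    height′ = trans (cong (_∸ r * suc d) (sym (+-suc (r * suc d) x)))
                (trans (m+n∸m≡n (r * suc d) (suc x)) (+-comm 1 x))
    height₂ : suc t ∸ r * d ≡ x + r + 1
    height₂ = begin
      suc (r * suc d + x) ∸ r * d   ≡⟨ cong (λ z → suc (z + x) ∸ r * d) (*-suc r d) ⟩
      suc (r + r * d + x) ∸ r * d   ≡⟨ cong (_∸ r * d) (shuffle r (r * d) x) ⟩
      r * d + (x + r + 1) ∸ r * d   ≡⟨ m+n∸m≡n (r * d) _ ⟩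
      x + r + 1                     ∎
      where
      shuffle : ∀ a b c → suc (a + b + c) ≡ b + (c + a + 1)
      shuffle = solve-∀
    h₁ : A₁ * M ≡ x * binom M (suc d)
    h₁ = trans closed₁ (cong (_* binom M (suc d)) height)
    h₂ : A₂ * M ≡ (x + r + 1) * binom M d
    h₂ = begin
      A₂ * M                                ≡⟨ cong (A₂ *_) (+-suc t d) ⟩
      A₂ * suc (t + d)                      ≡⟨ closed₂ ⟩
      (suc t ∸ r * d) * binom (suc (t + d)) d ≡⟨ cong₂ (λ a b → a * binom b d) height₂ (sym (+-suc t d)) ⟩
      (x + r + 1) * binom M d               ∎

  ballot-closed : ∀ u d → ballot u d * suc (u + d) ≡ (suc u ∸ r * d) * binom (suc (u + d)) d
  ballot-closed u zero rewrite *-zeroʳ r | +-identityʳ u =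
    trans (*-identityˡ _) (sym (*-identityʳ _))
  ballot-closed zero (suc d) rewrite 0∸n≡0 (r * d) | m≤n⇒m∸n≡0 {1} {r * suc d} (s≤s z≤n) = refl
  ballot-closed (suc u) (suc d) with downStep (suc u) d
  ... | blocked guard t<r[d+1] rewrite guard =
    blocked-step (suc u) d (ballot u (suc d)) t<r[d+1] (ballot-closed u (suc d))
  ... | allowed guard x t≡ rewrite guard =
    allowed-step (suc u) d x (ballot u (suc d)) (ballot (suc u) d) t≡
      (ballot-closed u (suc d)) (ballot-closed (suc u) d)

  ballot-return : ∀ n → ballot (r * n) n ≡ binom (n + r * n) n / suc (r * n)
  ballot-return n = sym (begin
    binom N n / suc (r * n)                        ≡⟨ cong (_/ suc (r * n)) (sym times-rn+1) ⟩
    ballot (r * n) n * suc (r * n) / suc (r * n)   ≡⟨ m*n/n≡m (ballot (r * n) n) (suc (r * n)) ⟩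
    ballot (r * n) n                               ∎)
    where
    open ≡-Reasoning
    N = n + r * n
    closed : ballot (r * n) n * suc N ≡ binom (suc N) n
    closed = begin
      ballot (r * n) n * suc N
        ≡⟨ cong (λ z → ballot (r * n) n * suc z) (+-comm n (r * n)) ⟩
      ballot (r * n) n * suc (r * n + n)
        ≡⟨ ballot-closed (r * n) n ⟩
      (suc (r * n) ∸ r * n) * binom (suc (r * n + n)) n
        ≡⟨ cong₂ (λ a b → a * binom (suc b) n) (m+n∸n≡m 1 (r * n)) (+-comm (r * n) n) ⟩
      1 * binom (suc N) n
        ≡⟨ *-identityˡ _ ⟩
      binom (suc N) n ∎
    times-rn+1 : ballot (r * n) n * suc (r * n) ≡ binom N n
    times-rn+1 = *-cancelʳ-≡ _ _ (suc N) (begin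
      ballot (r * n) n * suc (r * n) * suc N  ≡⟨ swap (ballot (r * n) n) (suc (r * n)) (suc N) ⟩
      ballot (r * n) n * suc N * suc (r * n)  ≡⟨ cong (_* suc (r * n)) closed ⟩
      binom (suc N) n * suc (r * n)           ≡⟨ binom-shift n (r * n) ⟩
      binom N n * suc N                       ∎)
      where
      swap : ∀ a b c → a * b * c ≡ a * c * b
      swap = solve-∀

module Process (k m : ℕ) where

  open Ballot k using (r; ifDownStep; ballot)

  -- (output word , stack with its top first)
  Config : Set
  Config = List ℕ × List ℕ

  push : ℕ → Config → Config
  push p (o , s) = (o , p ∷ s)

  pop : Config → List Config
  pop (o , s) = if r ≤ᵇ length s then (o ++ take r s , drop r s) ∷ [] else []

  popEach : List Config → List Config
  popEach []       = []
  popEach (c ∷ cs) = pop c ++ popEach cs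

  reach : ℕ → ℕ → List Config
  reach zero    zero    = ([] , []) ∷ []
  reach (suc u) zero    = map (push (m ∸ u)) (reach u zero)
  reach zero    (suc d) = popEach (reach zero d)
  reach (suc u) (suc d) = map (push (m ∸ u)) (reach u (suc d)) ++ popEach (reach (suc u) d)

  largest : ℕ → List ℕ
  largest zero    = []
  largest (suc u) = (m ∸ u) ∷ largest u

  Shrubs : ℕ → List ℕ → Set
  Shrubs d o = ∀ i j → i < d → 1 ≤ j → j ≤ k → at o (r * i) < at o (r * i + j)

  record Inv (u d : ℕ) (c : Config) : Set where
    field
      perm    : proj₁ c ++ proj₂ c ↭ largest u
      stack<  : AllPairs _<_ (proj₂ c)
      length≡ : length (proj₁ c) ≡ r * d
      shrubs  : Shrubs d (proj₁ c)
      free    : Free132 (proj₁ c ++ proj₂ c)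
  open Inv

  largest-above : ∀ u → u ≤ m → All (m ∸ u <_) (largest u)
  largest-above zero    _   = []
  largest-above (suc u) u<m = next<prev ∷ All.map (<-trans next<prev) (largest-above u (<⇒≤ u<m))
    where
    next<prev : m ∸ suc u < m ∸ u
    next<prev = ∸-monoʳ-< {m} {suc u} {u} (n<1+n u) u<m

  largest-atLeast : ∀ u → suc u ≤ m → All (m ∸ u ≤_) (largest (suc u))
  largest-atLeast u u<m = ≤-refl ∷ All.map <⇒≤ (largest-above u (<⇒≤ u<m))

  largest-unique : ∀ u → u ≤ m → Unique (largest u)
  largest-unique zero    _   = []
  largest-unique (suc u) u<m =
    All.map (λ next< next≡ → <-irrefl next≡ next<) (largest-above u (<⇒≤ u<m))
      ∷ largest-unique u (<⇒≤ u<m)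

  largest-length : ∀ u → length (largest u) ≡ u
  largest-length zero    = refl
  largest-length (suc u) = cong suc (largest-length u)

  largest-all : largest m ≡ map suc (upTo m)
  largest-all = trans (largest-from m 0 refl) (sym (map-upTo suc m))
    where
    applyUpTo-cong : ∀ {f g : ℕ → ℕ} n → (∀ i → f i ≡ g i) → applyUpTo f n ≡ applyUpTo g n
    applyUpTo-cong zero    f≗g = refl
    applyUpTo-cong (suc n) f≗g = cong₂ _∷_ (f≗g 0) (applyUpTo-cong n (λ i → f≗g (suc i)))
    largest-from : ∀ j t → t + j ≡ m → largest j ≡ applyUpTo (λ i → suc (t + i)) j
    largest-from zero    t _   = refl
    largest-from (suc j) t t+j+1≡m = cong₂ _∷_ first (trans
      (largest-from j (suc t) (trans (sym (+-suc t j)) t+j+1≡m))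
      (applyUpTo-cong j (λ i → cong suc (sym (+-suc t i)))))
      where
      first : m ∸ j ≡ suc (t + 0)
      first = begin
        m ∸ j             ≡⟨ cong (_∸ j) (trans (sym t+j+1≡m) (+-suc t j)) ⟩
        suc t + j ∸ j     ≡⟨ m+n∸n≡m (suc t) j ⟩
        suc t             ≡⟨ cong suc (sym (+-identityʳ t)) ⟩
        suc (t + 0)       ∎
        where open ≡-Reasoning

  ∈-pop : ∀ {c o s} → c ∈ pop (o , s) → r ≤ length s × c ≡ (o ++ take r s , drop r s)
  ∈-pop {c} {o} {s} c∈ with r ≤ᵇ length s in guard
  ∈-pop {c} {o} {s} (here c≡) | true = ≤ᵇ⇒≤ r (length s) (subst T (sym guard) tt) , c≡

  pop-∈ : ∀ o b s → length b ≡ r → (o ++ b , s) ∈ pop (o , b ++ s)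
  pop-∈ o b s b≡r with r ≤ᵇ length (b ++ s) in guard
  ... | true  = here (cong₂ _,_ (cong (o ++_) (sym (take-prefix b r b≡r)))
                                (sym (drop-prefix b r b≡r)))
    where
    take-prefix : ∀ (b : List ℕ) n → length b ≡ n → take n (b ++ s) ≡ b
    take-prefix []      zero    _   = refl
    take-prefix (x ∷ b) (suc n) b≡n = cong (x ∷_) (take-prefix b n (suc-injective b≡n))
    drop-prefix : ∀ (b : List ℕ) n → length b ≡ n → drop n (b ++ s) ≡ s
    drop-prefix []      zero    _   = refl
    drop-prefix (x ∷ b) (suc n) b≡n = drop-prefix b n (suc-injective b≡n)
  ... | false = ⊥-elim (subst T guard (≤⇒≤ᵇ r≤length))
    where
    r≤length : r ≤ length (b ++ s)
    r≤length = subst (r ≤_) (sym (length-++ b)) (subst (_≤ length b + length s) b≡r (m≤m+n _ _))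

  ∈-popEach : ∀ {c} cs → c ∈ popEach cs → ∃[ c′ ] (c′ ∈ cs × c ∈ pop c′)
  ∈-popEach (c′ ∷ cs) c∈ with ∈-++⁻ (pop c′) c∈
  ... | inj₁ c∈pop = c′ , here refl , c∈pop
  ... | inj₂ c∈rest with ∈-popEach cs c∈rest
  ...   | c″ , c″∈ , c∈pop = c″ , there c″∈ , c∈pop

  popEach-∈ : ∀ {c c′} cs → c′ ∈ cs → c ∈ pop c′ → c ∈ popEach cs
  popEach-∈ (x ∷ cs) (here refl) c∈pop = ∈-++⁺ˡ c∈pop
  popEach-∈ (x ∷ cs) (there c′∈) c∈pop = ∈-++⁺ʳ (pop x) (popEach-∈ cs c′∈ c∈pop)

  shrub-index< : ∀ {i d j} → i < d → j ≤ k → r * i + j < r * d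
  shrub-index< {i} {d} {j} i<d j≤k = <-≤-trans (+-monoʳ-< (r * i) (s≤s j≤k))
    (≤-trans (≤-reflexive (trans (+-comm (r * i) r) (sym (*-suc r i)))) (*-monoʳ-≤ r i<d))

  root-index< : ∀ {i d} → i < d → r * i < r * d
  root-index< {i} {d} i<d = subst (_< r * d) (+-identityʳ (r * i)) (shrub-index< {i} {d} {0} i<d z≤n)

  shrubs-++ : ∀ o b d → length o ≡ r * d → Shrubs d o → Shrubs d (o ++ b)
  shrubs-++ o b d o≡ sh i j i<d 1≤j j≤k = subst₂ _<_
    (sym (at-++ˡ o b (r * i) (subst (_ <_) (sym o≡) (root-index< i<d))))
    (sym (at-++ˡ o b (r * i + j) (subst (_ <_) (sym o≡) (shrub-index< i<d j≤k))))
    (sh i j i<d 1≤j j≤k)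

  shrubs-snoc : ∀ o b d → length o ≡ r * d → AllPairs _<_ b → length b ≡ r →
    Shrubs d o → Shrubs (suc d) (o ++ b)
  shrubs-snoc o b d o≡ b< b≡r sh i j i<d+1 1≤j j≤k with m<1+n⇒m<n∨m≡n i<d+1
  ... | inj₁ i<d = shrubs-++ o b d o≡ sh i j i<d 1≤j j≤k
  ... | inj₂ refl = subst₂ _<_ (sym at-root) (sym (at-last j)) (root<leaf b j b< b≡r 1≤j j≤k)
    where
    at-root : at (o ++ b) (r * i) ≡ at b 0
    at-root = trans (cong (at (o ++ b)) (trans (sym o≡) (sym (+-identityʳ _)))) (at-++ʳ o b 0)
    at-last : ∀ j → at (o ++ b) (r * i + j) ≡ at b j
    at-last j = trans (cong (λ z → at (o ++ b) (z + j)) (sym o≡)) (at-++ʳ o b j)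
    root<leaf : ∀ b j → AllPairs _<_ b → length b ≡ r → 1 ≤ j → j ≤ k → at b 0 < at b j
    root<leaf (x ∷ ys) (suc j) (x< ∷ _) b≡r _ j≤k =
      All.lookup x< (at-∈ ys j (subst (j <_) (sym (suc-injective b≡r)) j≤k))

  -- Both steps preserve the invariant.  A push keeps the word 132-avoiding
  -- because the new value is the smallest one (free132-insert).
  push-inv : ∀ u d {c} → suc u ≤ m → Inv u d c → Inv (suc u) d (push (m ∸ u) c)
  push-inv u d {o , s} u<m I = record
    { perm    = ↭-trans (shift (m ∸ u) o s) (↭-prep (m ∸ u) (perm I))
    ; stack<  = All.++⁻ʳ o next< ∷ stack< I
    ; length≡ = length≡ I
    ; shrubs  = shrubs I
    ; free    = free132-insert o (free I) (stack< I) next< }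
    where
    next< : All (m ∸ u <_) (o ++ s)
    next< = All-resp-↭ (↭-sym (perm I)) (largest-above u (<⇒≤ u<m))

  pop-inv : ∀ u d {c c′} → Inv u d c′ → c ∈ pop c′ → Inv u (suc d) c
  pop-inv u d {c} {o , s} I c∈ with ∈-pop {c} {o} {s} c∈
  ... | r≤ , refl = record
    { perm    = subst (_↭ largest u) (sym same-word) (perm I)
    ; stack<  = AllPairs.drop⁺ r (stack< I)
    ; length≡ = trans (length-++ o) (trans (cong₂ _+_ (length≡ I) shrub-length)
                  (trans (+-comm (r * d) r) (sym (*-suc r d))))
    ; shrubs  = shrubs-snoc o (take r s) d (length≡ I) (AllPairs.take⁺ r (stack< I)) shrub-length (shrubs I)
    ; free    = subst Free132 (sym same-word) (free I) }
    where
    same-word : (o ++ take r s) ++ drop r s ≡ o ++ s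
    same-word = trans (++-assoc o (take r s) (drop r s)) (cong (o ++_) (take++drop≡id r s))
    shrub-length : length (take r s) ≡ r
    shrub-length = trans (length-take r s) (m≤n⇒m⊓n≡m r≤)

  All-popEach : ∀ {P Q : Config → Set} cs → All P cs →
    (∀ {c c′} → P c′ → c ∈ pop c′ → Q c) → All Q (popEach cs)
  All-popEach {Q = Q} cs Pcs P⇒Q = All.tabulate λ c∈ → from (∈-popEach cs c∈)
    where
    from : ∀ {c} → ∃[ c′ ] (c′ ∈ cs × c ∈ pop c′) → Q c
    from (c′ , c′∈ , c∈pop) = P⇒Q (All.lookup Pcs c′∈) c∈pop

  reach-inv : ∀ u d → u ≤ m → All (Inv u d) (reach u d)
  reach-inv zero zero _ = record
    { perm = ↭-refl ; stack< = [] ; length≡ = sym (*-zeroʳ r) ; shrubs = λ _ _ () ; free = λ () } ∷ []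
  reach-inv (suc u) zero u<m = All.map⁺ (All.map (push-inv u zero u<m) (reach-inv u zero (<⇒≤ u<m)))
  reach-inv zero (suc d) _ = All-popEach (reach zero d) (reach-inv zero d z≤n) (pop-inv zero d)
  reach-inv (suc u) (suc d) u<m = All.++⁺
    (All.map⁺ (All.map (push-inv u (suc d) u<m) (reach-inv u (suc d) (<⇒≤ u<m))))
    (All-popEach (reach (suc u) d) (reach-inv (suc u) d u<m) (pop-inv (suc u) d))

  -- Counting: the stack height after u pushes and d pops is u ∸ r d, so
  -- the number of reachable configurations obeys the ballot recurrence.
  stack-length : ∀ u d {c} → Inv u d c → length (proj₂ c) ≡ u ∸ r * d
  stack-length u d {o , s} I = trans (sym (m+n∸m≡n (length o) (length s)))
    (cong₂ _∸_ (trans (sym (length-++ o)) (trans (↭-length (perm I)) (largest-length u))) (length≡ I))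

  length-popEach : ∀ cs h → All (λ c → length (proj₂ c) ≡ h) cs →
    length (popEach cs) ≡ (if r ≤ᵇ h then length cs else 0)
  length-popEach [] h _ with r ≤ᵇ h
  ... | true  = refl
  ... | false = refl
  length-popEach ((o , s) ∷ cs) h (refl ∷ heights)
    rewrite length-++ (pop (o , s)) {popEach cs} | length-popEach cs h heights with r ≤ᵇ length s
  ... | true  = refl
  ... | false = refl

  length-reach : ∀ u d → u ≤ m → length (reach u d) ≡ ballot u d

  length-pops : ∀ u d → u ≤ m → length (popEach (reach u d)) ≡ ifDownStep u d (ballot u d)
  length-pops u d u≤m =
    trans (length-popEach (reach u d) (u ∸ r * d) (All.map (stack-length u d) (reach-inv u d u≤m)))
          (cong (ifDownStep u d) (length-reach u d u≤m))

  length-reach zero    zero    _   = refl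
  length-reach (suc u) zero    u<m =
    trans (length-map (push (m ∸ u)) (reach u zero)) (length-reach u zero (<⇒≤ u<m))
  length-reach zero    (suc d) _   = length-pops zero d z≤n
  length-reach (suc u) (suc d) u<m = trans (length-++ (map (push (m ∸ u)) (reach u (suc d))))
    (cong₂ _+_ (trans (length-map (push (m ∸ u)) (reach u (suc d))) (length-reach u (suc d) (<⇒≤ u<m)))
               (length-pops (suc u) d u<m))

  -- Uniqueness: pushes and pops from distinct configurations give distinct
  -- configurations, and a pushed configuration (next value on the stack)
  -- differs from a popped one (next value in the output).
  ++-cancel-length : ∀ (a c : List ℕ) {b d} → length a ≡ length c → a ++ b ≡ c ++ d → a ≡ c × b ≡ d
  ++-cancel-length []      []      _   eq = refl , eq
  ++-cancel-length (x ∷ a) (y ∷ c) a≡c eq with ∷-injective eq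
  ... | refl , eq′ with ++-cancel-length a c (suc-injective a≡c) eq′
  ...   | refl , b≡d = refl , b≡d

  pop-injective : ∀ {c o₁ s₁ o₂ s₂} → length o₁ ≡ length o₂ →
    c ∈ pop (o₁ , s₁) → c ∈ pop (o₂ , s₂) → (o₁ , s₁) ≡ (o₂ , s₂)
  pop-injective {c} {o₁} {s₁} {o₂} {s₂} o₁≡o₂ c∈₁ c∈₂
    with ∈-pop {c} {o₁} {s₁} c∈₁ | ∈-pop {c} {o₂} {s₂} c∈₂
  ... | _ , refl | _ , c≡ with ++-cancel-length o₁ o₂ o₁≡o₂ (cong proj₁ c≡)
  ...   | refl , take≡ = cong (o₁ ,_) (begin
    s₁                          ≡⟨ take++drop≡id r s₁ ⟨
    take r s₁ ++ drop r s₁      ≡⟨ cong₂ _++_ take≡ (cong proj₂ c≡) ⟩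
    take r s₂ ++ drop r s₂      ≡⟨ take++drop≡id r s₂ ⟩
    s₂                          ∎)
    where open ≡-Reasoning

  unique-pop : ∀ c → Unique (pop c)
  unique-pop (o , s) with r ≤ᵇ length s
  ... | true  = [] ∷ []
  ... | false = []

  unique-popEach : ∀ cs ℓ → Unique cs → All (λ c → length (proj₁ c) ≡ ℓ) cs → Unique (popEach cs)
  unique-popEach []       ℓ _          _              = []
  unique-popEach (c ∷ cs) ℓ (c∉ ∷ u) (c≡ℓ ∷ cs≡ℓ) =
    Unique.++⁺ (unique-pop c) (unique-popEach cs ℓ u cs≡ℓ) disjoint
    where
    disjoint : ∀ {v} → ¬ (v ∈ pop c × v ∈ popEach cs)
    disjoint (v∈ , v∈rest) with ∈-popEach cs v∈rest
    ... | c′ , c′∈ , v∈′ =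
      All.lookup c∉ c′∈ (pop-injective (trans c≡ℓ (sym (All.lookup cs≡ℓ c′∈))) v∈ v∈′)

  unique-pushEach : ∀ p cs → Unique cs → Unique (map (push p) cs)
  unique-pushEach p cs u = AllPairs.map⁺ (AllPairs.map (λ c≢ push≡ → c≢ (push-injective push≡)) u)
    where
    push-injective : ∀ {c₁ c₂} → push p c₁ ≡ push p c₂ → c₁ ≡ c₂
    push-injective {o , s} refl = refl

  word-unique : ∀ u d {c} → u ≤ m → Inv u d c → Unique (proj₁ c ++ proj₂ c)
  word-unique u d u≤m I = unique-resp-↭ (↭-sym (perm I)) (largest-unique u u≤m)

  -- After a pop, the value placed last lies in the output: it is the
  -- smallest value, so if it is on the stack it is on top.
  popped-output : ∀ u d {c c′} → suc u ≤ m → Inv (suc u) d c′ → c ∈ pop c′ → (m ∸ u) ∈ proj₁ c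
  popped-output u d {c} {o , s} u<m I c∈ with ∈-pop {c} {o} {s} c∈
  ... | _ , refl with ∈-++⁻ o (∈-resp-↭ (↭-sym (perm I)) (here refl))
  ...   | inj₁ next∈o = ∈-++⁺ˡ next∈o
  ...   | inj₂ next∈s = ∈-++⁺ʳ o (on-top s next∈s (stack< I)
                          (All.++⁻ʳ o (All-resp-↭ (↭-sym (perm I)) (largest-atLeast u u<m))))
    where
    on-top : ∀ s → (m ∸ u) ∈ s → AllPairs _<_ s → All (m ∸ u ≤_) s → (m ∸ u) ∈ take r s
    on-top (z ∷ s) (here next≡)   _         _        = here next≡
    on-top (z ∷ s) (there next∈) (z< ∷ _) (next≤z ∷ _) =
      ⊥-elim (<-irrefl refl (≤-<-trans next≤z (All.lookup z< next∈)))

  unique-reach : ∀ u d → u ≤ m → Unique (reach u d)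
  unique-reach zero    zero    _   = [] ∷ []
  unique-reach (suc u) zero    u<m = unique-pushEach (m ∸ u) (reach u zero) (unique-reach u zero (<⇒≤ u<m))
  unique-reach zero    (suc d) _   =
    unique-popEach (reach zero d) (r * d) (unique-reach zero d z≤n) (All.map length≡ (reach-inv zero d z≤n))
  unique-reach (suc u) (suc d) u<m = Unique.++⁺
    (unique-pushEach (m ∸ u) (reach u (suc d)) (unique-reach u (suc d) (<⇒≤ u<m)))
    (unique-popEach (reach (suc u) d) (r * d) (unique-reach (suc u) d u<m)
      (All.map length≡ (reach-inv (suc u) d u<m)))
    pushed≢popped
    where
    pushed≢popped : ∀ {v} → ¬ (v ∈ map (push (m ∸ u)) (reach u (suc d)) × v ∈ popEach (reach (suc u) d))
    pushed≢popped {v} (v∈pushed , v∈popped) with ∈-map⁻ (push (m ∸ u)) v∈pushed | ∈-popEach (reach (suc u) d) v∈popped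
    ... | (o , s) , _ , refl | c′ , c′∈ , v∈pop =
      unique-disjoint o
        (word-unique (suc u) (suc d) u<m (All.lookup (reach-inv (suc u) (suc d) u<m) (∈-++⁺ˡ v∈pushed)))
        (popped-output u d u<m (All.lookup (reach-inv (suc u) d u<m) c′∈) v∈pop) (here refl)

  unpush-inv : ∀ u d {o s} → Inv (suc u) d (o , (m ∸ u) ∷ s) → Inv u d (o , s)
  unpush-inv u d {o} {s} I = record
    { perm    = drop-∷ (↭-trans (↭-sym (shift (m ∸ u) o s)) (perm I))
    ; stack<  = tail (stack< I)
    ; length≡ = length≡ I
    ; shrubs  = shrubs I
    ; free    = free132-⊆ (++⁺ ⊆-refl ((m ∸ u) ∷ʳ ⊆-refl)) (free I) }
    where
    tail : ∀ {x xs} → AllPairs _<_ (x ∷ xs) → AllPairs _<_ xs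
    tail (_ ∷ xs<) = xs<

  shrubs-init : ∀ o b d → length o ≡ r * d → Shrubs (suc d) (o ++ b) → Shrubs d o
  shrubs-init o b d o≡ sh i j i<d 1≤j j≤k = subst₂ _<_
    (at-++ˡ o b (r * i) (subst (_ <_) (sym o≡) (root-index< i<d)))
    (at-++ˡ o b (r * i + j) (subst (_ <_) (sym o≡) (shrub-index< i<d j≤k)))
    (sh i j (m<n⇒m<1+n i<d) 1≤j j≤k)

  last-root< : ∀ o x ys d → length o ≡ r * d → length ys ≡ k →
    Shrubs (suc d) (o ++ x ∷ ys) → All (x <_) ys
  last-root< o x ys d o≡ ys≡k sh = All.tabulate λ y∈ → root<leaf (⊆-at (from∈ y∈))
    where
    at-last : ∀ j → at (o ++ x ∷ ys) (r * d + j) ≡ at (x ∷ ys) j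
    at-last j = trans (cong (λ z → at (o ++ x ∷ ys) (z + j)) (sym o≡)) (at-++ʳ o (x ∷ ys) j)
    root<leaf : ∀ {y} → ∃[ j ] (j < length ys × at ys j ≡ y) → x < y
    root<leaf (j , j<k , refl) =
      subst₂ _<_ (trans (cong (at (o ++ x ∷ ys)) (sym (+-identityʳ (r * d)))) (at-last 0)) (at-last (suc j))
        (sh d (suc j) (n<1+n d) (s≤s z≤n) (subst (j <_) ys≡k j<k))

  unpop-inv : ∀ u d o′ b s → suc u ≤ m → Inv (suc u) (suc d) (o′ ++ b , s) →
    (m ∸ u) ∈ o′ ++ b → length o′ ≡ r * d → length b ≡ r → Inv (suc u) d (o′ , b ++ s)
  unpop-inv u d o′ (x ∷ ys) s u<m I next∈ o′≡ b≡r = record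
    { perm    = subst (_↭ largest (suc u)) assoc (perm I)
    ; stack<  = last-shrub-increasing o′ x ys s (m ∸ u)
                  (subst Unique assoc (word-unique (suc u) (suc d) u<m I))
                  (subst Free132 assoc (free I)) (stack< I)
                  (last-root< o′ x ys d o′≡ (suc-injective b≡r) (shrubs I)) next∈
                  (subst (All (m ∸ u ≤_)) assoc
                    (All-resp-↭ (↭-sym (perm I)) (largest-atLeast u u<m)))
    ; length≡ = o′≡
    ; shrubs  = shrubs-init o′ (x ∷ ys) d o′≡ (shrubs I)
    ; free    = subst Free132 assoc (free I) }
    where
    assoc : (o′ ++ x ∷ ys) ++ s ≡ o′ ++ x ∷ ys ++ s
    assoc = ++-assoc o′ (x ∷ ys) s

  unpop : ∀ u d {o s} → suc u ≤ m → Inv (suc u) (suc d) (o , s) → (m ∸ u) ∈ o →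
    ∃[ c′ ] (Inv (suc u) d c′ × (o , s) ∈ pop c′)
  unpop u d {o} {s} u<m I next∈ =
    (o′ , b ++ s) ,
    unpop-inv u d o′ b s u<m (subst (λ z → Inv (suc u) (suc d) (z , s)) (sym o′++b≡o) I)
      (subst ((m ∸ u) ∈_) (sym o′++b≡o) next∈) o′≡ b≡r ,
    subst (λ z → (z , s) ∈ pop (o′ , b ++ s)) o′++b≡o (pop-∈ o′ b s b≡r)
    where
    o′ = take (r * d) o
    b  = drop (r * d) o
    o′++b≡o : o′ ++ b ≡ o
    o′++b≡o = take++drop≡id (r * d) o
    rd≤o : r * d ≤ length o
    rd≤o = subst (r * d ≤_) (sym (length≡ I)) (*-monoʳ-≤ r (n≤1+n d))
    o′≡ : length o′ ≡ r * d
    o′≡ = trans (length-take (r * d) o) (m≤n⇒m⊓n≡m rd≤o)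
    b≡r : length b ≡ r
    b≡r = trans (length-drop (r * d) o)
      (trans (cong (_∸ r * d) (trans (length≡ I) (*-suc r d))) (m+n∸n≡m r (r * d)))

  -- The last step of a configuration with u+1 values placed: the value
  -- m ∸ u placed last is either on top of the stack (last step a push)
  -- or in the output (last step a pop).
  data LastStep (u : ℕ) (o s : List ℕ) : Set where
    pushed : ∀ s′ → s ≡ (m ∸ u) ∷ s′ → LastStep u o s
    popped : (m ∸ u) ∈ o → LastStep u o s

  lastStep : ∀ u d {o s} → suc u ≤ m → Inv (suc u) d (o , s) → LastStep u o s
  lastStep u d {o} {s} u<m I with ∈-++⁻ o (∈-resp-↭ (↭-sym (perm I)) (here refl))
  ... | inj₁ next∈o = popped next∈o
  ... | inj₂ next∈s = on-top s next∈s (stack< I)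
                        (All.++⁻ʳ o (All-resp-↭ (↭-sym (perm I)) (largest-atLeast u u<m)))
    where
    on-top : ∀ s → (m ∸ u) ∈ s → AllPairs _<_ s → All (m ∸ u ≤_) s → LastStep u o s
    on-top (z ∷ s) (here next≡)   _         _        = pushed s (cong (_∷ s) (sym next≡))
    on-top (z ∷ s) (there next∈) (z< ∷ _) (next≤z ∷ _) =
      ⊥-elim (<-irrefl refl (≤-<-trans next≤z (All.lookup z< next∈)))

  undo-last-step : ∀ u d {o s} → suc u ≤ m → Inv (suc u) (suc d) (o , s) →
    (∀ {o s} → Inv u (suc d) (o , s) → (o , s) ∈ reach u (suc d)) →
    (∀ {o s} → Inv (suc u) d (o , s) → (o , s) ∈ reach (suc u) d) →
    (o , s) ∈ reach (suc u) (suc d)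
  undo-last-step u d u<m I complete-push complete-pop with lastStep u (suc d) u<m I
  ... | pushed s′ refl = ∈-++⁺ˡ (∈-map⁺ (push (m ∸ u)) (complete-push (unpush-inv u (suc d) I)))
  ... | popped next∈o with unpop u d u<m I next∈o
  ...   | c′ , I′ , c∈pop = ∈-++⁺ʳ (map (push (m ∸ u)) (reach u (suc d)))
    (popEach-∈ (reach (suc u) d) (complete-pop I′) c∈pop)

  reach-complete : ∀ u d → u ≤ m → ∀ {o s} → Inv u d (o , s) → (o , s) ∈ reach u d
  reach-complete zero zero _ {o} {s} I = initial o s (↭-empty-inv (perm I))
    where
    initial : ∀ o s → o ++ s ≡ [] → (o , s) ∈ reach zero zero
    initial [] [] _ = here refl
  reach-complete zero (suc d) _ {o} {s} I = ⊥-elim (no-shrub o s (↭-empty-inv (perm I)) (length≡ I))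
    where
    no-shrub : ∀ o s → o ++ s ≡ [] → length o ≡ r * suc d → ⊥
    no-shrub [] s _ ()
  reach-complete (suc u) zero u<m {o} {s} I with lastStep u zero u<m I
  ... | pushed s′ refl =
    ∈-map⁺ (push (m ∸ u)) (reach-complete u zero (<⇒≤ u<m) (unpush-inv u zero I))
  ... | popped next∈o = ⊥-elim (empty-output o next∈o (trans (length≡ I) (*-zeroʳ r)))
    where
    empty-output : ∀ (o : List ℕ) {x} → x ∈ o → length o ≡ 0 → ⊥
    empty-output (_ ∷ _) _ ()
  reach-complete (suc u) (suc d) u<m I =
    undo-last-step u d u<m I (reach-complete u (suc d) (<⇒≤ u<m)) (reach-complete (suc u) d u<m)

module Forests (k n : ℕ) where

  m : ℕ
  m = suc k * n

  open Process k m
  open Inv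

  final-stack : ∀ {c} → Inv m n c → proj₂ c ≡ []
  final-stack {o , s} I = empty s (trans (stack-length m n I) (n∸n≡0 m))
    where
    empty : ∀ (s : List ℕ) → length s ≡ 0 → s ≡ []
    empty [] _ = refl

  final-inv⇔forest : ∀ π → Inv m n (π , []) ⇔ InF132 k n π
  final-inv⇔forest π = mk⇔
    (λ I → (subst₂ _↭_ (++-identityʳ π) largest-all (perm I) , shrubs I)
           , Equivalence.from (avoids⇔free132 π) (subst Free132 (++-identityʳ π) (free I)))
    (λ ((π↭ , sh) , av) → record
      { perm    = subst₂ _↭_ (sym (++-identityʳ π)) (sym largest-all) π↭
      ; stack<  = []
      ; length≡ = trans (↭-length π↭) (trans (length-map suc (upTo m)) (length-upTo m))
      ; shrubs  = sh
      ; free    = subst Free132 (sym (++-identityʳ π)) (Equivalence.to (avoids⇔free132 π) av) })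

  forests : List (List ℕ)
  forests = map proj₁ (reach m n)

  -- distinct final configurations have distinct outputs, stacks being empty
  forests-unique : Unique forests
  forests-unique = Unique.map⁻ (subst Unique (sym (restore _ final-stacks)) (unique-reach m n ≤-refl))
    where
    final-stacks : All (λ c → proj₂ c ≡ []) (reach m n)
    final-stacks = All.map final-stack (reach-inv m n ≤-refl)
    restore : ∀ cs → All (λ c → proj₂ c ≡ []) cs → map (_, []) (map proj₁ cs) ≡ cs
    restore []              []            = refl
    restore ((o , .[]) ∷ cs) (refl ∷ cs≡) = cong ((o , []) ∷_) (restore cs cs≡)

  forests-complete : ∀ π → π ∈ forests ⇔ InF132 k n π
  forests-complete π = mk⇔ to from
    where
    to : π ∈ forests → InF132 k n π
    to π∈ with ∈-map⁻ proj₁ π∈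
    ... | (.π , s) , c∈ , refl with All.lookup (reach-inv m n ≤-refl) c∈
    ...   | I with final-stack I
    ...     | refl = Equivalence.to (final-inv⇔forest π) I
    from : InF132 k n π → π ∈ forests
    from forest = ∈-map⁺ proj₁ (reach-complete m n ≤-refl (Equivalence.from (final-inv⇔forest π) forest))

  forests-length : length forests ≡ ((2 + k) * n C n) / (1 + suc k * n)
  forests-length = begin
    length forests                          ≡⟨ length-map proj₁ (reach m n) ⟩
    length (reach m n)            ≡⟨ length-reach m n ≤-refl ⟩
    Ballot.ballot k m n                    ≡⟨ Ballot.ballot-return k n ⟩
    binom (n + suc k * n) n / suc (suc k * n) ≡⟨ cong (_/ suc (suc k * n)) (binom≡C (n + suc k * n) n) ⟩
    ((2 + k) * n C n) / (1 + suc k * n)     ∎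
    where open ≡-Reasoning

theorem6 : (k n : ℕ) → 1 ≤ k →
    ∃[ L ] (Unique L × (∀ (π : List ℕ) → (π ∈ L) ⇔ InF132 k n π) ×
    length L ≡ ((2 + k) * n C n) / (1 + (suc k) * n))
theorem6 k n _ = forests , forests-unique , forests-complete , forests-length
  where open Forests k n
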